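{- For any $j\ge1$ and any positive integers $k_1,\dots,k_j,m,l$, \[ C_{(k_1,\dots,k_j,m)}(q,t)=C_{(k_1,\dots,k_j,l)}(q,t). \]
   Context: Let $\vec k=(k_1,\dots,k_n)$ be a vector of positive integers and $K=k_1+\dots+k_n$. A $\vec k$-Dyck path is a lattice path from $(0,0)$ to $(K,K)$ of the form $N^{k_1}E^{a_1}N^{k_2}E^{a_2}\cdots N^{k_n}E^{a_n}$, where $N=(0,1)$, $E=(1,0)$, the $a_i$ are nonnegative integers summing to $K$, and the path never goes below $y=x$ (equivalently $a_1+\dots+a_i\le k_1+\dots+k_i$ for all $i$). The segment $N^{k_j}$ is the $j$-th north step; consecutive north steps are counted separately. The red ranks are $r_j=\sum_{i<j}(k_i-a_i)$ and $\mathrm{area}(D)=r_1+\dots+r_n$. Bounce (Xin–Zhang algorithm): let $R$ be an initially empty diagram with columns $1,\dots,n$, column $j$ having $k_j+1$ cells. Set $i=0$, $P_0=(0,0)$. While $P_i\neq(K,K)$: (1) let $Q_i$ be the starting point of the unique east step of $D$ starting at the $x$-coordinate of $P_i$; the $y$-coordinate of $P_i$ is $k_1+\dots+k_s$ and that of $Q_i$ is $k_1+\dots+k_{s+v_i}$ for some $v_i\ge0$; (2) fill the leftmost $v_i$ unfilled columns of $R$, column $j$ receiving entries $i,i+1,\dots,i+k_j$ from top to bottom; (3) let $h_i$ be the number of filled cells of $R$ containing $i+1$ and set $P_{i+1}=(x(Q_i)+h_i,y(Q_i))$; (4) increase $i$ by 1. Then $\mathrm{bounce}(D)=\sum_{i\ge0}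 i\,v_i$. The refined $q,t$-Catalan number is $C_{\vec k}(q,t)=\sum_{D}q^{\mathrm{area}(D)}t^{\mathrm{bounce}(D)}$, the sum over all $\vec k$-Dyck paths $D$. -}

module Defs where

open import Data.Nat using (ℕ; zero; suc; _+_; _*_; _∸_; _≤_; _<_; _≤?_; _<?_; _≟_)
open import Data.List using (List; []; _∷_; length; map; filter; take; concatMap; upTo; applyUpTo)
open import Data.Nat.ListAction using (sum)
open import Data.Product using (_×_; _,_)
open import Relation.Nullary using (Dec; yes; no)
open import Relation.Nullary.Decidable using (_×-dec_)

-- A k⃗ = (k₁,…,kₙ) is a list of positive naturals; a k⃗-Dyck path
-- N^{k₁}E^{a₁}⋯N^{kₙ}E^{aₙ} is encoded by its list of east-run lengths (a₁,…,aₙ).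

PrefixOK : ℕ → ℕ → List ℕ → List ℕ → Set
PrefixOK sk sa []       _        = Data.Unit.⊤ where import Data.Unit
PrefixOK sk sa (k ∷ ks) []       = Data.Unit.⊤ where import Data.Unit
PrefixOK sk sa (k ∷ ks) (a ∷ as) = (sa + a ≤ sk + k) × PrefixOK (sk + k) (sa + a) ks as

prefixOK? : ∀ sk sa ks as → Dec (PrefixOK sk sa ks as)
prefixOK? sk sa []       _        = yes Data.Unit.tt where import Data.Unit
prefixOK? sk sa (k ∷ ks) []       = yes Data.Unit.tt where import Data.Unit
prefixOK? sk sa (k ∷ ks) (a ∷ as) = (sa + a ≤? sk + k) ×-dec prefixOK? (sk + k) (sa + a) ks as

IsDyck : List ℕ → List ℕ → Set
IsDyck ks as = (length as ≡ length ks) × (sum as ≡ sum ks) × PrefixOK 0 0 ks as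
  where open import Relation.Binary.PropositionalEquality using (_≡_)

isDyck? : ∀ ks as → Dec (IsDyck ks as)
isDyck? ks as = (length as ≟ length ks) ×-dec ((sum as ≟ sum ks) ×-dec prefixOK? 0 0 ks as)

tuples : ℕ → ℕ → List (List ℕ)
tuples zero    b = [] ∷ []
tuples (suc n) b = concatMap (λ a → map (a ∷_) (tuples n b)) (upTo (suc b))

dyckPaths : List ℕ → List (List ℕ)
dyckPaths ks = filter (isDyck? ks) (tuples (length ks) (sum ks))

-- red ranks r_j = Σ_{i<j} (kᵢ - aᵢ)  (nonnegative for Dyck paths), area = Σ r_j
area : List ℕ → List ℕ → ℕ
area ks as = sum (applyUpTo (λ j → sum (take j ks) ∸ sum (take j as)) (length ks))

-- Bounce (Xin–Zhang algorithm)

-- index t (1-based) of the first prefix sum a₁+⋯+a_t exceeding x;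
-- the unique east step starting at x-coordinate x begins at height k₁+⋯+k_t.
firstExceed : ℕ → ℕ → List ℕ → ℕ
firstExceed x acc []       = 0
firstExceed x acc (a ∷ as) with x <? acc + a
... | yes _ = 1
... | no  _ = suc (firstExceed x (acc + a) as)

-- columns s+1,…,t of R (k-values), i.e. the next v = t - s unfilled columns
slice : ℕ → ℕ → List ℕ → List ℕ
slice s t ks = Data.List.drop s (take t ks)

-- a filled column of R: (k_j , e_j) where it holds entries e_j, e_j+1, …, e_j+k_j
Column : Set
Column = ℕ × ℕ

-- h = number of filled cells containing the value c
countContaining : ℕ → List Column → ℕ
countContaining c []             = 0
countContaining c ((k , e) ∷ cs) with e ≤? c | c ≤? e + k
... | yes _ | yes _ = suc (countContaining c cs)
... | _     | _     = countContaining c cs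

-- state: iteration i, x-coordinate x of Pᵢ, number s of filled columns
-- (y(Pᵢ) = k₁+⋯+k_s), filled columns, accumulated Σ i·vᵢ.
-- Loop stops once Pᵢ = (K,K), i.e. x(Pᵢ) reaches K; 'fuel' bounds the iterations
-- (the algorithm finishes in at most K iterations, each moving x forward).
bounceLoop : ℕ → List ℕ → List ℕ → ℕ → ℕ → ℕ → List Column → ℕ → ℕ
bounceLoop zero       ks as i x s cols acc = acc
bounceLoop (suc fuel) ks as i x s cols acc with x <? sum ks
... | no  _ = acc
... | yes _ =
  let t     = firstExceed x 0 as
      v     = t ∸ s
      cols′ = cols Data.List.++ map (λ k → (k , i)) (slice s t ks)
      h     = countContaining (suc i) cols′
  in bounceLoop fuel ks as (suc i) (x + h) t cols′ (acc + i * v)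

bounce : List ℕ → List ℕ → ℕ
bounce ks as = bounceLoop (suc (2 * sum ks + length ks)) ks as 0 0 0 [] 0

-- coefficient of q^α t^β in C_{k⃗}(q,t) = Σ_D q^{area D} t^{bounce D}
qtCatalanCoeff : List ℕ → ℕ → ℕ → ℕ
qtCatalanCoeff ks α β =
  length (filter (λ as → (area ks as ≟ α) ×-dec (bounce ks as ≟ β)) (dyckPaths ks))

module Submission where

-- A (k₁,…,k_j,m)-Dyck path is a k⃗-prefix path a₁…a_j (the prefix condition for k⃗) followed by a
-- last east run that is forced to be K + m − (a₁+⋯+a_j), so for every m ≥ 1 the paths are indexed
-- by the same prefix paths and it suffices that area and bounce do not see m. The area only gains
-- the last red rank K − (a₁+⋯+a_j). In the bounce algorithm the last north step enters only in the
-- iteration that fills the last column of R: before it both runs coincide, after it every vᵢ is 0.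
-- What makes the run well behaved is the invariant y(Pᵢ) − x(Pᵢ) = #{cells of R with entry > i};
-- while the last column is unfilled this count is positive, so x(Pᵢ) strictly increases and stays ≤ K.

open import Defs
open import Data.Bool using (Bool; true; false; _∧_)
open import Data.List using (List; []; _∷_; _++_; _∷ʳ_; length; map; take; drop; filter; concatMap; upTo; applyUpTo)
open import Data.List.Properties using (length-++; upTo-∷ʳ; applyUpTo-∷ʳ; take-all; take++drop≡id; take-take)
open import Data.List.Relation.Unary.All as ListAll using ([]; _∷_)
open import Data.List.Relation.Unary.All.Properties using (concat⁺; map⁺; ++⁺; applyUpTo⁺₁)
open import Data.Nat using (ℕ; zero; suc; _+_; _*_; _∸_; _≤_; _<_; _≤?_; _<?_; _≟_; z≤n; s≤s)
open import Data.Nat.ListAction using (sum)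
open import Data.Nat.ListAction.Properties using (sum-++)
open import Data.Nat.Properties
open import Algebra.Properties.CommutativeSemigroup +-commutativeSemigroup using (x∙yz≈y∙xz)
open import Data.Product using (Σ; _×_; _,_)
open import Data.Sum using (inj₁; inj₂)
open import Data.Vec using (Vec; toList)
open import Data.Vec.Relation.Unary.All using (All)
open import Function using (id)
open import Function.Bundles using (_⇔_; mk⇔)
open import Level using (0ℓ)
open import Relation.Nullary using (Dec; does; yes; no; contradiction; _×-dec_)
open import Relation.Nullary.Decidable using (dec-false; does-⇔)
open import Relation.Unary using (Pred; Decidable)
open import Relation.Binary.PropositionalEquality

private
  variable
    A B : Set

-- Weighted sums over lists

indicator : Bool → ℕ
indicator true  = 1
indicator false = 0

∑ : (A → ℕ) → List A → ℕ
∑ h []       = 0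
∑ h (x ∷ xs) = h x + ∑ h xs

∑-cong : {h h′ : A → ℕ} → (∀ x → h x ≡ h′ x) → ∀ xs → ∑ h xs ≡ ∑ h′ xs
∑-cong h≗h′ []       = refl
∑-cong h≗h′ (x ∷ xs) = cong₂ _+_ (h≗h′ x) (∑-cong h≗h′ xs)

∑-cong-All : {h h′ : A → ℕ} {xs : List A} → ListAll.All (λ x → h x ≡ h′ x) xs → ∑ h xs ≡ ∑ h′ xs
∑-cong-All []       = refl
∑-cong-All (e ∷ es) = cong₂ _+_ e (∑-cong-All es)

∑-zero : {h : A → ℕ} {xs : List A} → ListAll.All (λ x → h x ≡ 0) xs → ∑ h xs ≡ 0
∑-zero []       = refl
∑-zero (e ∷ es) = cong₂ _+_ e (∑-zero es)

∑-++ : (h : A → ℕ) (xs ys : List A) → ∑ h (xs ++ ys) ≡ ∑ h xs + ∑ h ys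
∑-++ h []       ys = refl
∑-++ h (x ∷ xs) ys = trans (cong (h x +_) (∑-++ h xs ys)) (sym (+-assoc (h x) _ _))

∑-map : (h : B → ℕ) (f : A → B) (xs : List A) → ∑ h (map f xs) ≡ ∑ (λ x → h (f x)) xs
∑-map h f []       = refl
∑-map h f (x ∷ xs) = cong (h (f x) +_) (∑-map h f xs)

∑-concatMap : (h : B → ℕ) (f : A → List B) (xs : List A) → ∑ h (concatMap f xs) ≡ ∑ (λ x → ∑ h (f x)) xs
∑-concatMap h f []       = refl
∑-concatMap h f (x ∷ xs) = trans (∑-++ h (f x) _) (cong (∑ h (f x) +_) (∑-concatMap h f xs))

length-filter-filter : {P Q : Pred A 0ℓ} (P? : Decidable P) (Q? : Decidable Q) (xs : List A) →
  length (filter Q? (filter P? xs)) ≡ ∑ (λ x → indicator (does (P? x) ∧ does (Q? x))) xs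
length-filter-filter P? Q? []       = refl
length-filter-filter P? Q? (x ∷ xs) with does (P? x)
... | false = length-filter-filter P? Q? xs
... | true with does (Q? x)
...   | false = length-filter-filter P? Q? xs
...   | true  = cong suc (length-filter-filter P? Q? xs)

upTo-< : ∀ n → ListAll.All (_< n) (upTo n)
upTo-< n = applyUpTo⁺₁ id n id

∑-upTo-suc : (h : ℕ → ℕ) (n : ℕ) → ∑ h (upTo (suc n)) ≡ ∑ h (upTo n) + h n
∑-upTo-suc h n = begin
  ∑ h (upTo (suc n))        ≡⟨ cong (∑ h) (upTo-∷ʳ n) ⟨
  ∑ h (upTo n ∷ʳ n)         ≡⟨ ∑-++ h (upTo n) (n ∷ []) ⟩
  ∑ h (upTo n) + (h n + 0)  ≡⟨ cong (∑ h (upTo n) +_) (+-identityʳ (h n)) ⟩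
  ∑ h (upTo n) + h n        ∎
  where open ≡-Reasoning

∑-upTo-vanishing : (h : ℕ → ℕ) (n d : ℕ) → (∀ a → n ≤ a → h a ≡ 0) → ∑ h (upTo (n + d)) ≡ ∑ h (upTo n)
∑-upTo-vanishing h n zero    _ rewrite +-identityʳ n = refl
∑-upTo-vanishing h n (suc d) vanish = begin
  ∑ h (upTo (n + suc d))          ≡⟨ cong (λ k → ∑ h (upTo k)) (+-suc n d) ⟩
  ∑ h (upTo (suc (n + d)))        ≡⟨ ∑-upTo-suc h (n + d) ⟩
  ∑ h (upTo (n + d)) + h (n + d)  ≡⟨ cong₂ _+_ (∑-upTo-vanishing h n d vanish) (vanish (n + d) (m≤m+n n d)) ⟩
  ∑ h (upTo n) + 0                ≡⟨ +-identityʳ _ ⟩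
  ∑ h (upTo n)                    ∎
  where open ≡-Reasoning

∑-upTo-single : (h : ℕ → ℕ) {c n : ℕ} → c < n → (∀ a → a ≢ c → h a ≡ 0) → ∑ h (upTo n) ≡ h c
∑-upTo-single h {c} {n} c<n vanish = begin
  ∑ h (upTo n)                      ≡⟨ cong (λ k → ∑ h (upTo k)) (m+[n∸m]≡n c<n) ⟨
  ∑ h (upTo (suc c + (n ∸ suc c)))  ≡⟨ ∑-upTo-vanishing h (suc c) (n ∸ suc c) (λ a c<a → vanish a (>⇒≢ c<a)) ⟩
  ∑ h (upTo (suc c))                ≡⟨ ∑-upTo-suc h c ⟩
  ∑ h (upTo c) + h c                ≡⟨ cong (_+ h c) (∑-zero (ListAll.map (λ a<c → vanish _ (<⇒≢ a<c)) (upTo-< c))) ⟩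
  h c                               ∎
  where open ≡-Reasoning

tuples-length : ∀ n B → ListAll.All (λ t → length t ≡ n) (tuples n B)
tuples-length zero    B = refl ∷ []
tuples-length (suc n) B =
  concat⁺ (map⁺ (ListAll.universal (λ a → map⁺ (ListAll.map (cong suc) (tuples-length n B))) (upTo (suc B))))

∑-tuples-suc : (h : List ℕ → ℕ) (n B : ℕ) →
  ∑ h (tuples (suc n) B) ≡ ∑ (λ a → ∑ (λ t → h (a ∷ t)) (tuples n B)) (upTo (suc B))
∑-tuples-suc h n B = trans (∑-concatMap h (λ a → map (a ∷_) (tuples n B)) (upTo (suc B)))
                           (∑-cong (λ a → ∑-map h (a ∷_) (tuples n B)) (upTo (suc B)))

∑-tuples-∷ʳ : (h : List ℕ → ℕ) (n B : ℕ) →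
  ∑ h (tuples (suc n) B) ≡ ∑ (λ t → ∑ (λ a → h (t ∷ʳ a)) (upTo (suc B))) (tuples n B)
∑-tuples-∷ʳ h zero B =
  trans (∑-tuples-suc h zero B) (trans (∑-cong (λ a → +-identityʳ (h (a ∷ []))) (upTo (suc B))) (sym (+-identityʳ _)))
∑-tuples-∷ʳ h (suc n) B = begin
  ∑ h (tuples (suc (suc n)) B)
    ≡⟨ ∑-tuples-suc h (suc n) B ⟩
  ∑ (λ a → ∑ (λ t → h (a ∷ t)) (tuples (suc n) B)) (upTo (suc B))
    ≡⟨ ∑-cong (λ a → ∑-tuples-∷ʳ (λ t → h (a ∷ t)) n B) (upTo (suc B)) ⟩
  ∑ (λ a → ∑ (λ t → ∑ (λ c → h (a ∷ t ∷ʳ c)) (upTo (suc B))) (tuples n B)) (upTo (suc B))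
    ≡⟨ ∑-tuples-suc (λ t → ∑ (λ c → h (t ∷ʳ c)) (upTo (suc B))) n B ⟨
  ∑ (λ t → ∑ (λ c → h (t ∷ʳ c)) (upTo (suc B))) (tuples (suc n) B)
    ∎
  where open ≡-Reasoning

∑-tuples-bounded : (h : List ℕ → ℕ) (n B d : ℕ) →
  (∀ t → length t ≡ n → h t ≢ 0 → ListAll.All (_≤ B) t) → ∑ h (tuples n (B + d)) ≡ ∑ h (tuples n B)
∑-tuples-bounded h zero    B d supported = refl
∑-tuples-bounded h (suc n) B d supported = begin
  ∑ h (tuples (suc n) (B + d))
    ≡⟨ ∑-tuples-suc h n (B + d) ⟩
  ∑ (λ a → ∑ (λ t → h (a ∷ t)) (tuples n (B + d))) (upTo (suc B + d))
    ≡⟨ ∑-upTo-vanishing _ (suc B) d (λ a B<a → ∑-zero (ListAll.map (vanish B<a) (tuples-length n (B + d)))) ⟩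
  ∑ (λ a → ∑ (λ t → h (a ∷ t)) (tuples n (B + d))) (upTo (suc B))
    ≡⟨ ∑-cong-All (ListAll.map (λ {a} _ → ∑-tuples-bounded (λ t → h (a ∷ t)) n B d (supported-tail a))
                               (upTo-< (suc B))) ⟩
  ∑ (λ a → ∑ (λ t → h (a ∷ t)) (tuples n B)) (upTo (suc B))
    ≡⟨ ∑-tuples-suc h n B ⟨
  ∑ h (tuples (suc n) B)
    ∎
  where
  open ≡-Reasoning
  supported-tail : ∀ a t → length t ≡ n → h (a ∷ t) ≢ 0 → ListAll.All (_≤ B) t
  supported-tail a t lt h≢0 = ListAll.tail (supported (a ∷ t) (cong suc lt) h≢0)
  vanish : ∀ {a} → B < a → ∀ {t} → length t ≡ n → h (a ∷ t) ≡ 0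
  vanish {a} B<a {t} lt with h (a ∷ t) ≟ 0
  ... | yes h≡0 = h≡0
  ... | no  h≢0 = contradiction (ListAll.head (supported (a ∷ t) (cong suc lt) h≢0)) (<⇒≱ B<a)

-- Prefix sums and the prefix condition

length-∷ʳ : (xs : List A) (x : A) → length (xs ∷ʳ x) ≡ suc (length xs)
length-∷ʳ xs x = trans (length-++ xs) (+-comm (length xs) 1)

sum-∷ʳ : (xs : List ℕ) (x : ℕ) → sum (xs ∷ʳ x) ≡ sum xs + x
sum-∷ʳ xs x = trans (sum-++ xs (x ∷ [])) (cong (sum xs +_) (+-identityʳ x))

take-∷ʳ : ∀ n (xs : List A) x → n ≤ length xs → take n (xs ∷ʳ x) ≡ take n xs
take-∷ʳ zero    xs       x _        = refl
take-∷ʳ (suc n) (y ∷ xs) x (s≤s n≤) = cong (y ∷_) (take-∷ʳ n xs x n≤)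

slice-∷ʳ : ∀ s t (xs : List ℕ) x → t ≤ length xs → slice s t (xs ∷ʳ x) ≡ slice s t xs
slice-∷ʳ s t xs x t≤ = cong (drop s) (take-∷ʳ t xs x t≤)

applyUpTo-cong : ∀ {f g : ℕ → A} n → (∀ {j} → j < n → f j ≡ g j) → applyUpTo f n ≡ applyUpTo g n
applyUpTo-cong zero    _   = refl
applyUpTo-cong (suc n) f≗g = cong₂ _∷_ (f≗g (s≤s z≤n)) (applyUpTo-cong n (λ j<n → f≗g (s≤s j<n)))

sum-take-mono : ∀ {m n} (xs : List ℕ) → m ≤ n → sum (take m xs) ≤ sum (take n xs)
sum-take-mono {zero}          xs       _         = z≤n
sum-take-mono {suc m} {suc n} []       _         = z≤n
sum-take-mono {suc m} {suc n} (x ∷ xs) (s≤s m≤n) = +-monoʳ-≤ x (sum-take-mono xs m≤n)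

sum-take-≤ : ∀ n (xs : List ℕ) → sum (take n xs) ≤ sum xs
sum-take-≤ n xs = subst (sum (take n xs) ≤_) take+drop (m≤m+n _ _)
  where
  take+drop : sum (take n xs) + sum (drop n xs) ≡ sum xs
  take+drop = trans (sym (sum-++ (take n xs) (drop n xs))) (cong sum (take++drop≡id n xs))

sum-take+sum-slice : ∀ {s t} (xs : List ℕ) → s ≤ t → sum (take s xs) + sum (slice s t xs) ≡ sum (take t xs)
sum-take+sum-slice {s} {t} xs s≤t = begin
  sum (take s xs) + sum (drop s (take t xs))          ≡⟨ cong (λ ys → sum ys + sum (drop s (take t xs))) take-s ⟨
  sum (take s (take t xs)) + sum (drop s (take t xs)) ≡⟨ sum-++ (take s (take t xs)) _ ⟨
  sum (take s (take t xs) ++ drop s (take t xs))      ≡⟨ cong sum (take++drop≡id s (take t xs)) ⟩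
  sum (take t xs)                                     ∎
  where
  open ≡-Reasoning
  take-s : take s (take t xs) ≡ take s xs
  take-s = trans (take-take s t xs) (cong (λ n → take n xs) (m≤n⇒m⊓n≡m s≤t))

All-≤-sum : (xs : List ℕ) → ListAll.All (_≤ sum xs) xs
All-≤-sum []       = []
All-≤-sum (x ∷ xs) = m≤m+n x (sum xs) ∷ ListAll.map (λ y≤ → ≤-trans y≤ (m≤n+m (sum xs) x)) (All-≤-sum xs)

prefixOK⇒sum-take-≤ : ∀ {sk sa} (P b : List ℕ) → sa ≤ sk → length b ≡ length P → PrefixOK sk sa P b →
  ∀ s → sa + sum (take s b) ≤ sk + sum (take s P)
prefixOK⇒sum-take-≤ P       b       sa≤sk _ _ zero    = +-monoˡ-≤ 0 sa≤sk
prefixOK⇒sum-take-≤ []      []      sa≤sk _ _ (suc s) = +-monoˡ-≤ 0 sa≤sk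
prefixOK⇒sum-take-≤ {sk} {sa} (k ∷ P) (a ∷ b) _ lb (≤k , ok) (suc s) =
  subst₂ _≤_ (+-assoc sa a _) (+-assoc sk k _) (prefixOK⇒sum-take-≤ P b ≤k (suc-injective lb) ok s)

prefixOK⇒sum-≤ : (P b : List ℕ) → length b ≡ length P → PrefixOK 0 0 P b → sum b ≤ sum P
prefixOK⇒sum-≤ P b lb ok = subst₂ _≤_ (cong sum (take-all (length P) b (≤-reflexive lb)))
                                      (cong sum (take-all (length P) P ≤-refl))
                                      (prefixOK⇒sum-take-≤ P b z≤n lb ok (length P))

prefixOK-∷ʳ⁻ : ∀ {sk sa m a} (P b : List ℕ) → length b ≡ length P →
  PrefixOK sk sa (P ∷ʳ m) (b ∷ʳ a) → PrefixOK sk sa P b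
prefixOK-∷ʳ⁻ []      []      _  _         = _
prefixOK-∷ʳ⁻ (k ∷ P) (c ∷ b) lb (≤k , ok) = ≤k , prefixOK-∷ʳ⁻ P b (suc-injective lb) ok

prefixOK-∷ʳ⁺ : ∀ {sk sa m a} (P b : List ℕ) → length b ≡ length P →
  PrefixOK sk sa P b → sa + sum (b ∷ʳ a) ≤ sk + sum (P ∷ʳ m) → PrefixOK sk sa (P ∷ʳ m) (b ∷ʳ a)
prefixOK-∷ʳ⁺ {sk} {sa} {m} {a} [] [] _ _ last≤ =
  subst₂ _≤_ (cong (sa +_) (+-identityʳ a)) (cong (sk +_) (+-identityʳ m)) last≤ , _
prefixOK-∷ʳ⁺ {sk} {sa} (k ∷ P) (c ∷ b) lb (≤k , ok) last≤ =
  ≤k , prefixOK-∷ʳ⁺ P b (suc-injective lb) ok (subst₂ _≤_ (sym (+-assoc sa c _)) (sym (+-assoc sk k _)) last≤)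

-- Dyck paths with a given last north step: counting and area

finalRun : List ℕ → ℕ → List ℕ → ℕ
finalRun P m b = sum P + m ∸ sum b

module _ (P : List ℕ) (m : ℕ) {Q : Pred (List ℕ) 0ℓ} (Q? : Decidable Q) where

  prefixWeight : List ℕ → ℕ
  prefixWeight b = indicator (does (prefixOK? 0 0 P b) ∧ does (Q? (b ∷ʳ finalRun P m b)))

  private
    dyckWeight : List ℕ → ℕ
    dyckWeight as = indicator (does (isDyck? (P ∷ʳ m) as) ∧ does (Q? as))

  isDyck-∷ʳ⇒finalRun : ∀ {b} a → IsDyck (P ∷ʳ m) (b ∷ʳ a) → a ≡ finalRun P m b
  isDyck-∷ʳ⇒finalRun {b} a (_ , sums , _) = begin
    a                  ≡⟨ m+n∸m≡n (sum b) a ⟨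
    sum b + a ∸ sum b  ≡⟨ cong (_∸ sum b) (trans (sym (sum-∷ʳ b a)) (trans sums (sum-∷ʳ P m))) ⟩
    sum P + m ∸ sum b  ∎
    where open ≡-Reasoning

  isDyck-∷ʳ-finalRun⇔prefixOK : ∀ {b} → length b ≡ length P →
    IsDyck (P ∷ʳ m) (b ∷ʳ finalRun P m b) ⇔ PrefixOK 0 0 P b
  isDyck-∷ʳ-finalRun⇔prefixOK {b} lb = mk⇔
    (λ (_ , _ , ok) → prefixOK-∷ʳ⁻ P b lb ok)
    (λ ok → lengths , sums ok , prefixOK-∷ʳ⁺ P b lb ok (≤-reflexive (sums ok)))
    where
    lengths : length (b ∷ʳ finalRun P m b) ≡ length (P ∷ʳ m)
    lengths = trans (length-∷ʳ b _) (trans (cong suc lb) (sym (length-∷ʳ P m)))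
    sums : PrefixOK 0 0 P b → sum (b ∷ʳ finalRun P m b) ≡ sum (P ∷ʳ m)
    sums ok = begin
      sum (b ∷ʳ finalRun P m b)    ≡⟨ sum-∷ʳ b _ ⟩
      sum b + (sum P + m ∸ sum b)  ≡⟨ m+[n∸m]≡n (≤-trans (prefixOK⇒sum-≤ P b lb ok) (m≤m+n (sum P) m)) ⟩
      sum P + m                    ≡⟨ sum-∷ʳ P m ⟨
      sum (P ∷ʳ m)                 ∎
      where open ≡-Reasoning

  ∑-dyckWeight-∷ʳ : ∀ {b} → length b ≡ length P →
    ∑ (λ a → dyckWeight (b ∷ʳ a)) (upTo (suc (sum P + m))) ≡ prefixWeight b
  ∑-dyckWeight-∷ʳ {b} lb = trans
    (∑-upTo-single (λ a → dyckWeight (b ∷ʳ a)) (s≤s (m∸n≤m (sum P + m) (sum b))) not-final)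
    (cong (λ d → indicator (d ∧ does (Q? (b ∷ʳ finalRun P m b))))
          (does-⇔ (isDyck-∷ʳ-finalRun⇔prefixOK lb) (isDyck? (P ∷ʳ m) (b ∷ʳ finalRun P m b)) (prefixOK? 0 0 P b)))
    where
    not-final : ∀ a → a ≢ finalRun P m b → dyckWeight (b ∷ʳ a) ≡ 0
    not-final a a≢ = cong (λ d → indicator (d ∧ does (Q? (b ∷ʳ a))))
      (dec-false (isDyck? (P ∷ʳ m) (b ∷ʳ a)) (λ dyck → a≢ (isDyck-∷ʳ⇒finalRun a dyck)))

  count-dyckPaths-∷ʳ : length (filter Q? (dyckPaths (P ∷ʳ m))) ≡ ∑ prefixWeight (tuples (length P) (sum P))
  count-dyckPaths-∷ʳ = begin
    length (filter Q? (dyckPaths (P ∷ʳ m)))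
      ≡⟨ length-filter-filter (isDyck? (P ∷ʳ m)) Q? (tuples (length (P ∷ʳ m)) (sum (P ∷ʳ m))) ⟩
    ∑ dyckWeight (tuples (length (P ∷ʳ m)) (sum (P ∷ʳ m)))
      ≡⟨ cong₂ (λ n B → ∑ dyckWeight (tuples n B)) (length-∷ʳ P m) (sum-∷ʳ P m) ⟩
    ∑ dyckWeight (tuples (suc (length P)) (sum P + m))
      ≡⟨ ∑-tuples-∷ʳ dyckWeight (length P) (sum P + m) ⟩
    ∑ (λ b → ∑ (λ a → dyckWeight (b ∷ʳ a)) (upTo (suc (sum P + m)))) (tuples (length P) (sum P + m))
      ≡⟨ ∑-cong-All (ListAll.map ∑-dyckWeight-∷ʳ (tuples-length (length P) (sum P + m))) ⟩
    ∑ prefixWeight (tuples (length P) (sum P + m))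
      ≡⟨ ∑-tuples-bounded prefixWeight (length P) (sum P) m bounded ⟩
    ∑ prefixWeight (tuples (length P) (sum P))
      ∎
    where
    open ≡-Reasoning
    bounded : ∀ b → length b ≡ length P → prefixWeight b ≢ 0 → ListAll.All (_≤ sum P) b
    bounded b lb w≢0 with prefixOK? 0 0 P b
    ... | no  _  = contradiction refl w≢0
    ... | yes ok = ListAll.map (λ c≤ → ≤-trans c≤ (prefixOK⇒sum-≤ P b lb ok)) (All-≤-sum b)

area-∷ʳ : (P b : List ℕ) (m a : ℕ) → length b ≡ length P → area (P ∷ʳ m) (b ∷ʳ a) ≡ area P b + (sum P ∸ sum b)
area-∷ʳ P b m a lb = begin
  sum (applyUpTo rank (length (P ∷ʳ m)))  ≡⟨ cong (λ n → sum (applyUpTo rank n)) (length-∷ʳ P m) ⟩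
  sum (applyUpTo rank (suc N))            ≡⟨ cong sum (applyUpTo-∷ʳ rank N) ⟨
  sum (applyUpTo rank N ∷ʳ rank N)        ≡⟨ sum-∷ʳ (applyUpTo rank N) (rank N) ⟩
  sum (applyUpTo rank N) + rank N         ≡⟨ cong₂ _+_ (cong sum (applyUpTo-cong N (λ j<N → rank≡rankᴾ (<⇒≤ j<N))))
                                                       (rank≡rankᴾ ≤-refl) ⟩
  sum (applyUpTo rankᴾ N) + rankᴾ N       ≡⟨ cong (area P b +_) (cong₂ _∸_ (cong sum (take-all N P ≤-refl))
                                                                          (cong sum (take-all N b (≤-reflexive lb)))) ⟩
  area P b + (sum P ∸ sum b)              ∎
  where
  open ≡-Reasoning
  N : ℕ
  N = length P
  rank rankᴾ : ℕ → ℕ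
  rank  j = sum (take j (P ∷ʳ m)) ∸ sum (take j (b ∷ʳ a))
  rankᴾ j = sum (take j P) ∸ sum (take j b)
  rank≡rankᴾ : ∀ {j} → j ≤ N → rank j ≡ rankᴾ j
  rank≡rankᴾ j≤N = cong₂ _∸_ (cong sum (take-∷ʳ _ P m j≤N))
                             (cong sum (take-∷ʳ _ b a (subst (_ ≤_) (sym lb) j≤N)))

-- Bounce

-- A column (k , e) of R holds e, e+1, …, e+k; when e ≤ i exactly e + k ∸ i of its cells exceed i.
cellsAbove : ℕ → List Column → ℕ
cellsAbove i = ∑ (λ (k , e) → e + k ∸ i)

FilledBy : ℕ → List Column → Set
FilledBy i = ListAll.All (λ (k , e) → e ≤ i)

cellsAbove-new : ∀ i (ks : List ℕ) → cellsAbove i (map (λ k → (k , i)) ks) ≡ sum ks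
cellsAbove-new i []       = refl
cellsAbove-new i (k ∷ ks) = cong₂ _+_ (m+n∸m≡n i k) (cellsAbove-new i ks)

suc-∸ : ∀ {n i} → suc i ≤ n → n ∸ i ≡ suc (n ∸ suc i)
suc-∸ {suc n} (s≤s i≤n) = +-∸-assoc 1 i≤n

countContaining-cellsAbove : ∀ i cols → FilledBy i cols →
  countContaining (suc i) cols + cellsAbove (suc i) cols ≡ cellsAbove i cols
countContaining-cellsAbove i [] _ = refl
countContaining-cellsAbove i ((k , e) ∷ cols) (e≤i ∷ filled) with e ≤? suc i | suc i ≤? e + k
... | no e≰ | _ = contradiction (m≤n⇒m≤1+n e≤i) e≰
... | yes _ | yes i<top = begin
  suc (countContaining (suc i) cols + ((e + k ∸ suc i) + cellsAbove (suc i) cols))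
    ≡⟨ cong suc (x∙yz≈y∙xz (countContaining (suc i) cols) (e + k ∸ suc i) (cellsAbove (suc i) cols)) ⟩
  suc ((e + k ∸ suc i) + (countContaining (suc i) cols + cellsAbove (suc i) cols))
    ≡⟨ cong (λ n → suc ((e + k ∸ suc i) + n)) (countContaining-cellsAbove i cols filled) ⟩
  suc (e + k ∸ suc i) + cellsAbove i cols
    ≡⟨ cong (_+ cellsAbove i cols) (suc-∸ i<top) ⟨
  (e + k ∸ i) + cellsAbove i cols
    ∎
  where open ≡-Reasoning
... | yes _ | no  i≮top
  rewrite m≤n⇒m∸n≡0 (≤-pred (≰⇒> i≮top)) | m≤n⇒m∸n≡0 (m≤n⇒m≤1+n (≤-pred (≰⇒> i≮top))) =
  countContaining-cellsAbove i cols filled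

countContaining-pos : ∀ i cols → FilledBy i cols → 0 < cellsAbove i cols → 0 < countContaining (suc i) cols
countContaining-pos i ((k , e) ∷ cols) (e≤i ∷ filled) above>0 with e ≤? suc i | suc i ≤? e + k
... | no e≰ | _     = contradiction (m≤n⇒m≤1+n e≤i) e≰
... | yes _ | yes _ = s≤s z≤n
... | yes _ | no  i≮top rewrite m≤n⇒m∸n≡0 (≤-pred (≰⇒> i≮top)) =
  countContaining-pos i cols filled above>0

firstExceed-ignores-last : ∀ x acc (b : List ℕ) a a′ → firstExceed x acc (b ∷ʳ a) ≡ firstExceed x acc (b ∷ʳ a′)
firstExceed-ignores-last x acc [] a a′ with x <? acc + a | x <? acc + a′
... | yes _ | yes _ = refl
... | yes _ | no  _ = refl
... | no  _ | yes _ = refl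
... | no  _ | no  _ = refl
firstExceed-ignores-last x acc (c ∷ b) a a′ with x <? acc + c
... | yes _ = refl
... | no  _ = cong suc (firstExceed-ignores-last x (acc + c) b a a′)

firstExceed-∷ʳ-beyond : ∀ x acc (b : List ℕ) a → acc + sum b ≤ x → firstExceed x acc (b ∷ʳ a) ≡ suc (length b)
firstExceed-∷ʳ-beyond x acc [] a _ with x <? acc + a
... | yes _ = refl
... | no  _ = refl
firstExceed-∷ʳ-beyond x acc (c ∷ b) a reached with x <? acc + c
... | yes x< = contradiction (≤-trans (+-monoʳ-≤ acc (m≤m+n c (sum b))) reached) (<⇒≱ x<)
... | no  _  = cong suc (firstExceed-∷ʳ-beyond x (acc + c) b a (≤-trans (≤-reflexive (+-assoc acc c (sum b))) reached))

firstExceed-∷ʳ-spec : ∀ x acc (b : List ℕ) a → acc ≤ x →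
  Σ ℕ λ t → firstExceed x acc (b ∷ʳ a) ≡ suc t × t ≤ length b ×
            acc + sum (take t b) ≤ x × (t < length b → x < acc + sum (take (suc t) b))
firstExceed-∷ʳ-spec x acc [] a acc≤x with x <? acc + a
... | yes _ = 0 , refl , z≤n , subst (_≤ x) (sym (+-identityʳ acc)) acc≤x , λ ()
... | no  _ = 0 , refl , z≤n , subst (_≤ x) (sym (+-identityʳ acc)) acc≤x , λ ()
firstExceed-∷ʳ-spec x acc (c ∷ b) a acc≤x with x <? acc + c
... | yes x< = 0 , refl , z≤n , subst (_≤ x) (sym (+-identityʳ acc)) acc≤x ,
               λ _ → subst (x <_) (cong (acc +_) (sym (+-identityʳ c))) x<
... | no  x≮ with firstExceed-∷ʳ-spec x (acc + c) b a (≮⇒≥ x≮)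
...   | t , t≡ , t≤ , reached , exceeds =
  suc t , cong suc t≡ , s≤s t≤ , subst (_≤ x) (+-assoc acc c _) reached ,
  λ t< → subst (x <_) (+-assoc acc c _) (exceeds (≤-pred t<))

bounceLoop-finished : ∀ f ks (b : List ℕ) a i x cols acc → sum b ≤ x →
  bounceLoop f ks (b ∷ʳ a) i x (suc (length b)) cols acc ≡ acc
bounceLoop-finished zero    ks b a i x cols acc _ = refl
bounceLoop-finished (suc f) ks b a i x cols acc reached with x <? sum ks
... | no  _ = refl
... | yes _ rewrite firstExceed-∷ʳ-beyond x 0 b a reached | n∸n≡0 (length b) | *-zeroʳ i | +-identityʳ acc =
  bounceLoop-finished f ks b a (suc i) _ _ acc (≤-trans reached (m≤m+n x _))

≤sum⇒<sum-∷ʳ : ∀ {x m} (P : List ℕ) → 1 ≤ m → x ≤ sum P → x < sum (P ∷ʳ m)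
≤sum⇒<sum-∷ʳ {x} {m} P 1≤m x≤ = subst (x <_) (sym (sum-∷ʳ P m)) (≤-<-trans x≤ (m<m+n (sum P) 1≤m))

module _ (P b : List ℕ) (lb : length b ≡ length P) (dominated : ∀ s → sum (take s b) ≤ sum (take s P)) where

  -- The state (i, x, s, cols) of the loop describes Pᵢ = (x , k₁+⋯+k_s).
  record Invariant (i x s : ℕ) (cols : List Column) : Set where
    field
      filled  : FilledBy i cols
      balance : x + cellsAbove i cols ≡ sum (take s P)
      reached : sum (take (s ∸ 1) b) ≤ x

  invariant-≤ : ∀ {i x s cols} → Invariant i x s cols → x ≤ sum P
  invariant-≤ {i} {x} {s} {cols} inv =
    ≤-trans (m≤m+n x (cellsAbove i cols)) (≤-trans (≤-reflexive (Invariant.balance inv)) (sum-take-≤ s P))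

  invariant-step : ∀ {i x s cols} t → Invariant i x s cols → sum (take t b) ≤ x → x < sum (take (suc t) b) →
    let cols′ = cols ++ map (λ k → (k , i)) (slice s (suc t) P)
        x′    = x + countContaining (suc i) cols′
    in x < x′ × Invariant (suc i) x′ (suc t) cols′
  invariant-step {i} {x} {s} {cols} t inv reachedᵗ exceeds =
    m<m+n x (countContaining-pos i cols′ filled′ above>0) ,
    record { filled  = ListAll.map m≤n⇒m≤1+n filled′
           ; balance = balance′
           ; reached = ≤-trans reachedᵗ (m≤m+n x _) }
    where
    open Invariant inv
    open ≡-Reasoning
    new : List ℕ
    new = slice s (suc t) P
    cols′ : List Column
    cols′ = cols ++ map (λ k → (k , i)) new
    filled′ : FilledBy i cols′
    filled′ = ++⁺ filled (map⁺ (ListAll.universal (λ _ → ≤-refl) new))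
    s≤suc-t : ∀ s → sum (take (s ∸ 1) b) ≤ x → s ≤ suc t
    s≤suc-t zero    _        = z≤n
    s≤suc-t (suc s) reached′ = s≤s (≮⇒≥ (λ t<s → <⇒≱ exceeds (≤-trans (sum-take-mono b t<s) reached′)))
    above : x + cellsAbove i cols′ ≡ sum (take (suc t) P)
    above = begin
      x + cellsAbove i cols′
        ≡⟨ cong (x +_) (∑-++ _ cols (map (λ k → (k , i)) new)) ⟩
      x + (cellsAbove i cols + cellsAbove i (map (λ k → (k , i)) new))
        ≡⟨ cong (λ n → x + (cellsAbove i cols + n)) (cellsAbove-new i new) ⟩
      x + (cellsAbove i cols + sum new)
        ≡⟨ +-assoc x _ _ ⟨
      x + cellsAbove i cols + sum new
        ≡⟨ cong (_+ sum new) balance ⟩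
      sum (take s P) + sum new
        ≡⟨ sum-take+sum-slice P (s≤suc-t s reached) ⟩
      sum (take (suc t) P)
        ∎
    above>0 : 0 < cellsAbove i cols′
    above>0 = +-cancelˡ-< x 0 _ (subst (_< x + cellsAbove i cols′) (sym (+-identityʳ x))
                (<-≤-trans exceeds (≤-trans (dominated (suc t)) (≤-reflexive (sym above)))))
    balance′ : x + countContaining (suc i) cols′ + cellsAbove (suc i) cols′ ≡ sum (take (suc t) P)
    balance′ = begin
      x + countContaining (suc i) cols′ + cellsAbove (suc i) cols′
        ≡⟨ +-assoc x _ _ ⟩
      x + (countContaining (suc i) cols′ + cellsAbove (suc i) cols′)
        ≡⟨ cong (x +_) (countContaining-cellsAbove i cols′ filled′) ⟩
      x + cellsAbove i cols′
        ≡⟨ above ⟩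
      sum (take (suc t) P)
        ∎

  -- Both loops find the same next run t. While t ≤ length P they fill the same columns; once
  -- t = length P + 1 the state is final and both return acc. As x grows and stays ≤ sum P,
  -- sum P ∸ x bounds the number of iterations.
  bounceLoop-∷ʳ-independent : ∀ {m l a a′} f f′ i x s cols acc → 1 ≤ m → 1 ≤ l → Invariant i x s cols →
    sum P ∸ x < f → sum P ∸ x < f′ →
    bounceLoop f (P ∷ʳ m) (b ∷ʳ a) i x s cols acc ≡ bounceLoop f′ (P ∷ʳ l) (b ∷ʳ a′) i x s cols acc
  bounceLoop-∷ʳ-independent {m} {l} {a} {a′} (suc f) (suc f′) i x s cols acc 1≤m 1≤l inv (s≤s fuel) (s≤s fuel′)
    with x <? sum (P ∷ʳ m) | x <? sum (P ∷ʳ l)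
  ... | no  x≮ | _      = contradiction (≤sum⇒<sum-∷ʳ P 1≤m (invariant-≤ inv)) x≮
  ... | yes _  | no x≮  = contradiction (≤sum⇒<sum-∷ʳ P 1≤l (invariant-≤ inv)) x≮
  ... | yes _  | yes _
    rewrite firstExceed-ignores-last x 0 b a′ a
    with firstExceed-∷ʳ-spec x 0 b a z≤n
  ... | t , t≡ , t≤ , reached , exceeds rewrite t≡ with m≤n⇒m<n∨m≡n t≤
  ... | inj₂ refl = trans (bounceLoop-finished f _ b a (suc i) _ _ _ (≤-trans all-reached (m≤m+n x _)))
                          (sym (bounceLoop-finished f′ _ b a′ (suc i) _ _ _ (≤-trans all-reached (m≤m+n x _))))
    where
    all-reached : sum b ≤ x
    all-reached = subst (_≤ x) (cong sum (take-all (length b) b ≤-refl)) reached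
  ... | inj₁ t<
    rewrite slice-∷ʳ s (suc t) P m (subst (suc t ≤_) lb t<) | slice-∷ʳ s (suc t) P l (subst (suc t ≤_) lb t<)
    with invariant-step t inv reached (exceeds t<)
  ... | progress , inv′ = bounceLoop-∷ʳ-independent f f′ (suc i) _ (suc t) _ _ 1≤m 1≤l inv′
          (<-≤-trans (∸-monoʳ-< progress (invariant-≤ inv′)) fuel)
          (<-≤-trans (∸-monoʳ-< progress (invariant-≤ inv′)) fuel′)

bounce-∷ʳ-independent : ∀ (P b : List ℕ) {m l} a a′ → length b ≡ length P → PrefixOK 0 0 P b →
  1 ≤ m → 1 ≤ l →
  bounce (P ∷ʳ m) (b ∷ʳ a) ≡ bounce (P ∷ʳ l) (b ∷ʳ a′)
bounce-∷ʳ-independent P b {m} {l} a a′ lb ok 1≤m 1≤l =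
  bounceLoop-∷ʳ-independent P b lb (prefixOK⇒sum-take-≤ P b z≤n lb ok) _ _ 0 0 0 [] 0 1≤m 1≤l
    (record { filled = [] ; balance = refl ; reached = z≤n }) (enough-fuel m) (enough-fuel l)
  where
  enough-fuel : ∀ m → sum P < suc (2 * sum (P ∷ʳ m) + length (P ∷ʳ m))
  enough-fuel m = s≤s (≤-trans (≤-trans (m≤m+n (sum P) m) (≤-reflexive (sym (sum-∷ʳ P m))))
                               (≤-trans (m≤n*m (sum (P ∷ʳ m)) 2) (m≤m+n _ _)))

qtCatalanCoeff-∷ʳ-independent : ∀ (P : List ℕ) {m l} → 1 ≤ m → 1 ≤ l →
  ∀ α β → qtCatalanCoeff (P ∷ʳ m) α β ≡ qtCatalanCoeff (P ∷ʳ l) α β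
qtCatalanCoeff-∷ʳ-independent P {m} {l} 1≤m 1≤l α β = begin
  qtCatalanCoeff (P ∷ʳ m) α β              ≡⟨ count-dyckPaths-∷ʳ P m (hasStatistics (P ∷ʳ m)) ⟩
  ∑ (weight m) (tuples (length P) (sum P)) ≡⟨ ∑-cong-All (ListAll.map same-weight (tuples-length (length P) (sum P))) ⟩
  ∑ (weight l) (tuples (length P) (sum P)) ≡⟨ count-dyckPaths-∷ʳ P l (hasStatistics (P ∷ʳ l)) ⟨
  qtCatalanCoeff (P ∷ʳ l) α β              ∎
  where
  open ≡-Reasoning
  hasStatistics : ∀ ks as → Dec (area ks as ≡ α × bounce ks as ≡ β)
  hasStatistics ks as = (area ks as ≟ α) ×-dec (bounce ks as ≟ β)
  weight : ℕ → List ℕ → ℕ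
  weight n = prefixWeight P n (hasStatistics (P ∷ʳ n))
  same-weight : ∀ {b} → length b ≡ length P → weight m b ≡ weight l b
  same-weight {b} lb with prefixOK? 0 0 P b
  ... | no  _  = refl
  ... | yes ok = cong₂ (λ r s → indicator (does ((r ≟ α) ×-dec (s ≟ β))))
    (trans (area-∷ʳ P b m _ lb) (sym (area-∷ʳ P b l _ lb)))
    (bounce-∷ʳ-independent P b _ _ lb ok 1≤m 1≤l)

corollary6p2 : (j : ℕ) (ks : Vec ℕ (suc j)) (m l : ℕ) →
    All (λ k → 1 ≤ k) ks → 1 ≤ m → 1 ≤ l →
    ∀ α β → qtCatalanCoeff (toList ks ∷ʳ m) α β ≡ qtCatalanCoeff (toList ks ∷ʳ l) α β
corollary6p2 j ks m l _ = qtCatalanCoeff-∷ʳ-independent (toList ks)
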